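{- Let $k \geq 1$ and let $\tau_k$ be the permutation $1\,(k+2)\,2\,3\,\cdots\,(k+1)$ of $[k+2]$. Set $a(n) = \#\mathrm{Av}_n[1324,\tau_k]$ for $n \geq 2$. Then for every $n \geq k+1$, \[ a(n) = a(n-1) + \sum_{i=1}^{k-1} a(n-i), \] and $a(n) = F_{2n-4}$ for $n \in \{2,\dots,k\}$.
   Context: A circular permutation $[\pi]$ of size $n$ is the set of all rotations of a permutation $\pi$ of $[n]$; $[\sigma]$ contains $[\pi]$ if some rotation of $\sigma$ has a subsequence order-isomorphic to $\pi$, otherwise avoids it; $\mathrm{Av}_n[\pi_1,\dots,\pi_m]$ is the set of circular permutations of size $n$ avoiding each $[\pi_i]$. The Fibonacci numbers are indexed so that $F_0=F_1=1$ and $F_m=F_{m-1}+F_{m-2}$ for $m\ge2$ ($F_m$ is the number of compositions of $m$ into parts $1$ and $2$). -}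

module Defs where

open import Data.Nat using (ℕ; zero; suc; _+_; _≡ᵇ_; _<ᵇ_)
open import Data.Bool using (Bool; true; false; _∧_; not)
open import Data.List using (List; []; _∷_; _++_; map; concatMap; upTo; filterᵇ; length; take; drop; zip)
open import Data.Bool.ListAction using (any; all)
open import Data.Nat.ListAction using (sum)
open import Data.Product using (_,_)

_==ᵇ_ : Bool → Bool → Bool
true  ==ᵇ b = b
false ==ᵇ b = not b

subseqs : {A : Set} → List A → List (List A)
subseqs []       = [] ∷ []
subseqs (x ∷ xs) = map (x ∷_) (subseqs xs) ++ subseqs xs

ordIso : List ℕ → List ℕ → Bool
ordIso []       []       = true
ordIso []       (_ ∷ _)  = false
ordIso (_ ∷ _)  []       = false
ordIso (x ∷ xs) (y ∷ ys) =
  all (λ { (x' , y') → ((x <ᵇ x') ==ᵇ (y <ᵇ y')) ∧ ((x' <ᵇ x) ==ᵇ (y' <ᵇ y)) }) (zip xs ys)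
  ∧ ordIso xs ys

rotations : List ℕ → List (List ℕ)
rotations xs = map (λ i → drop i xs ++ take i xs) (upTo (length xs))

containsLin : List ℕ → List ℕ → Bool
containsLin σ π = any (λ s → ordIso s π) (subseqs σ)

containsCirc : List ℕ → List ℕ → Bool
containsCirc σ π = any (λ r → containsLin r π) (rotations σ)

avoidsAll : List (List ℕ) → List ℕ → Bool
avoidsAll πs σ = all (λ π → not (containsCirc σ π)) πs

allLists : ℕ → ℕ → List (List ℕ)
allLists n zero    = [] ∷ []
allLists n (suc m) = concatMap (λ x → map (x ∷_) (allLists n m)) (upTo n)

distinct : List ℕ → Bool
distinct []       = true
distinct (x ∷ xs) = not (any (x ≡ᵇ_) xs) ∧ distinct xs

startsWithMin : List ℕ → Bool
startsWithMin []      = true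
startsWithMin (x ∷ _) = x ≡ᵇ 0

-- Canonical representatives of circular permutations of size n: the
-- permutations of {0,…,n-1} (i.e. of [n], shifted by one) whose first entry
-- is the minimum. Each rotation class contains exactly one of them.
circPerms : ℕ → List (List ℕ)
circPerms n = filterᵇ (λ σ → distinct σ ∧ startsWithMin σ) (allLists n n)

numAv : List (List ℕ) → ℕ → ℕ
numAv πs n = length (filterᵇ (avoidsAll πs) (circPerms n))

p1324 : List ℕ
p1324 = 1 ∷ 3 ∷ 2 ∷ 4 ∷ []

tau : ℕ → List ℕ
tau k = 1 ∷ (k + 2) ∷ map (2 +_) (upTo k)

aSeq : ℕ → ℕ → ℕ
aSeq k n = numAv (p1324 ∷ tau k ∷ []) n

-- Fibonacci with F₀ = F₁ = 1
fib : ℕ → ℕ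
fib zero          = 1
fib (suc zero)    = 1
fib (suc (suc m)) = fib (suc m) + fib m

sumFrom1 : ℕ → (ℕ → ℕ) → ℕ
sumFrom1 m f = sum (map (λ i → f (suc i)) (upTo m))

module Submission where

open import Defs
open import Data.Bool using (Bool; T; _∧_; not; true; false)
open import Data.Bool.Properties using (T-∧)
open import Data.Empty using (⊥; ⊥-elim)
open import Data.List using (List; []; _∷_; _++_; concatMap; drop; filterᵇ; last; length; map; take; upTo; zip)
open import Data.List.Membership.Propositional using (_∈_; find; lose)
open import Data.List.Membership.Propositional.Properties
  using (∈-++⁺ʳ; ∈-++⁺ˡ; ∈-++⁻; ∈-concatMap⁺; ∈-concatMap⁻; ∈-filter⁺; ∈-filter⁻;
         ∈-map⁺; ∈-map⁻; ∈-upTo⁺; ∈-upTo⁻; ∈-∃++)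
open import Data.List.Properties
  using (++-cancelʳ; ++-identityʳ; length-++; length-map; length-removeAt′; length-take; length-upTo;
         map-++; map-applyUpTo; map-cong-local; map-injective; map-upTo; take++drop≡id;
         ∷-injective; ∷-injectiveʳ; ∷-injectiveˡ)
open import Data.List.Relation.Binary.Sublist.Propositional
  using (_⊆_; []; _∷_; _∷ʳ_; from∈; minimum; ⊆-refl; ⊆-trans)
open import Data.List.Relation.Binary.Sublist.Propositional.Properties
  using (++⁺; ++⁺ʳ; ++⁺ˡ; All-resp-⊆; length-mono-≤; map⁺; take-⊆; ∷ʳ⁻; ∷⁻)
open import Data.List.Relation.Unary.All as All using (All; []; _∷_)
import Data.List.Relation.Unary.All.Properties as Allₚ
open import Data.List.Relation.Unary.AllPairs as AllPairs using (AllPairs; []; _∷_)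
import Data.List.Relation.Unary.AllPairs.Properties as APₚ
open import Data.List.Relation.Unary.Any using (_─_; here; index; there)
open import Data.List.Relation.Unary.Any.Properties using (any⁺; any⁻)
open import Data.List.Relation.Unary.Unique.Propositional using (Unique)
import Data.List.Relation.Unary.Unique.Propositional.Properties as Uniqueₚ
open import Data.Maybe using (just)
open import Data.Maybe.Properties using (just-injective)
open import Data.Nat using (ℕ; zero; suc; _+_; _*_; _∸_; _≤_; _<_; _⊓_; _<ᵇ_; _<?_; z≤n; s≤s; s≤s⁻¹)
open import Data.Nat.ListAction using (sum)
open import Data.Nat.Properties
open import Data.List.Membership.DecPropositional _≟_ using (_∈?_)
open import Data.Nat.Tactic.RingSolver using (solve-∀)
open import Data.Product using (Σ-syntax; _×_; _,_; proj₁; proj₂)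
open import Data.Sum using (_⊎_; inj₁; inj₂; [_,_]′)
open import Function using (_⇔_; mk⇔; Equivalence; _∘_; _on_)
open import Function.Construct.Composition using (_⇔-∘_)
open import Function.Construct.Symmetry using (⇔-sym)
open import Relation.Binary.PropositionalEquality
  using (_≡_; _≢_; refl; sym; trans; cong; cong₂; subst; subst₂; ≢-sym; module ≡-Reasoning)
open import Relation.Nullary using (¬_; yes; no)
open import Relation.Nullary.Decidable using (T?)

-- Rotating a circular permutation so that it starts with its minimum 0
-- identifies Av_{m+1}[1324, τ_k] with the permutations w of {1, …, m} such that
-- 0w avoids [1324] and [τ_k]. Since 0 is the minimum, this means that w avoids
-- the linear patterns 213, 4132 and (k+1)12⋯k (τ_k without its leading 1).
--
-- Write such a w of size m+1 as α1β. If α is empty, w = 1(β−1) and β−1 is an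
-- avoider of size m. Otherwise avoiding 213 puts β below α, avoiding 4132 makes β
-- increasing and avoiding (k+1)12⋯k gives j+1 < k for j = |β|, so 1β = 12⋯(j+1)
-- and α is an avoider of size m−j shifted up by j+1. Conversely both constructions
-- produce avoiders, injectively and with disjoint images, hence
--   a(m+2) = a(m+1) + Σ_{j < min(m, k−1)} a(m−j+1).
-- For n ≥ k+1 this is the stated recurrence. For n ≤ k the sum runs over all
-- j < m, and then a(t+2) and a(2) + ⋯ + a(t+2) are the consecutive Fibonacci
-- numbers F_{2t} and F_{2t+1}.

module _ {A : Set} where

  ∈-subseqs⁻ : ∀ (xs : List A) {s} → s ∈ subseqs xs → s ⊆ xs
  ∈-subseqs⁻ []       (here refl) = []
  ∈-subseqs⁻ (x ∷ xs) s∈ with ∈-++⁻ (map (x ∷_) (subseqs xs)) s∈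
  ... | inj₂ s∈′ = x ∷ʳ ∈-subseqs⁻ xs s∈′
  ... | inj₁ s∈′ with ∈-map⁻ (x ∷_) s∈′
  ...   | _ , s∈″ , refl = refl ∷ ∈-subseqs⁻ xs s∈″

  ∈-subseqs⁺ : ∀ {xs s : List A} → s ⊆ xs → s ∈ subseqs xs
  ∈-subseqs⁺ []                 = here refl
  ∈-subseqs⁺ (x ∷ʳ s⊆xs)        = ∈-++⁺ʳ _ (∈-subseqs⁺ s⊆xs)
  ∈-subseqs⁺ (refl ∷ s⊆xs)      = ∈-++⁺ˡ (∈-map⁺ _ (∈-subseqs⁺ s⊆xs))

  ⊆-++⁻ : ∀ (a b : List A) {s} → s ⊆ a ++ b →
    Σ[ s₁ ∈ List A ] Σ[ s₂ ∈ List A ] s ≡ s₁ ++ s₂ × s₁ ⊆ a × s₂ ⊆ b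
  ⊆-++⁻ []      b sub          = [] , _ , refl , [] , sub
  ⊆-++⁻ (x ∷ a) b (.x ∷ʳ sub)  =
    let s₁ , s₂ , eq , sub₁ , sub₂ = ⊆-++⁻ a b sub
    in s₁ , s₂ , eq , x ∷ʳ sub₁ , sub₂
  ⊆-++⁻ (x ∷ a) b (refl ∷ sub) =
    let s₁ , s₂ , eq , sub₁ , sub₂ = ⊆-++⁻ a b sub
    in x ∷ s₁ , s₂ , cong (x ∷_) eq , refl ∷ sub₁ , sub₂

  ++-⊆⁻ : ∀ (xs ys : List A) {σ} → xs ++ ys ⊆ σ → Σ[ i ∈ ℕ ] xs ⊆ take i σ × ys ⊆ drop i σ
  ++-⊆⁻ []       ys sub          = 0 , [] , sub
  ++-⊆⁻ (x ∷ xs) ys (y ∷ʳ sub)   =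
    let i , sub₁ , sub₂ = ++-⊆⁻ (x ∷ xs) ys sub in suc i , y ∷ʳ sub₁ , sub₂
  ++-⊆⁻ (x ∷ xs) ys (refl ∷ sub) =
    let i , sub₁ , sub₂ = ++-⊆⁻ xs ys sub in suc i , refl ∷ sub₁ , sub₂

  ∷-⊆-drop⇒< : ∀ i (σ : List A) {y ys} → y ∷ ys ⊆ drop i σ → i < length σ
  ∷-⊆-drop⇒< zero    (x ∷ σ) _   = s≤s z≤n
  ∷-⊆-drop⇒< (suc i) (x ∷ σ) sub = s≤s (∷-⊆-drop⇒< i σ sub)

module _ {A B : Set} (f : A → B) where

  map-⊆-++⁻ : ∀ zs (a b : List B) → map f zs ⊆ a ++ b →
    Σ[ z₁ ∈ List A ] Σ[ z₂ ∈ List A ] zs ≡ z₁ ++ z₂ × map f z₁ ⊆ a × map f z₂ ⊆ b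
  map-⊆-++⁻ []       a       b _           = [] , [] , refl , minimum a , minimum b
  map-⊆-++⁻ (z ∷ zs) []      b sub         = [] , z ∷ zs , refl , [] , sub
  map-⊆-++⁻ (z ∷ zs) (x ∷ a) b (.x ∷ʳ sub) =
    let z₁ , z₂ , eq , sub₁ , sub₂ = map-⊆-++⁻ (z ∷ zs) a b sub
    in z₁ , z₂ , eq , x ∷ʳ sub₁ , sub₂
  map-⊆-++⁻ (z ∷ zs) (x ∷ a) b (eq ∷ sub)  =
    let z₁ , z₂ , zs≡ , sub₁ , sub₂ = map-⊆-++⁻ zs a b sub
    in z ∷ z₁ , z₂ , cong (z ∷_) zs≡ , eq ∷ sub₁ , sub₂

  ⊆-map⁻ : ∀ (w : List A) {s} → s ⊆ map f w → Σ[ s′ ∈ List A ] s′ ⊆ w × s ≡ map f s′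
  ⊆-map⁻ []      []           = [] , [] , refl
  ⊆-map⁻ (x ∷ w) (_ ∷ʳ sub)   =
    let s′ , sub′ , eq = ⊆-map⁻ w sub in s′ , x ∷ʳ sub′ , eq
  ⊆-map⁻ (x ∷ w) (refl ∷ sub) =
    let s′ , sub′ , eq = ⊆-map⁻ w sub in x ∷ s′ , refl ∷ sub′ , cong (f x ∷_) eq

zip-unzip : ∀ {A B : Set} (zs : List (A × B)) → zip (map proj₁ zs) (map proj₂ zs) ≡ zs
zip-unzip []       = refl
zip-unzip (z ∷ zs) = cong (z ∷_) (zip-unzip zs)

module _ {A : Set} {R : A → A → Set} where

  AllPairs-++⁻ : ∀ xs {ys} → AllPairs R (xs ++ ys) →
    AllPairs R xs × AllPairs R ys × All (λ x → All (R x) ys) xs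
  AllPairs-++⁻ []       ap       = [] , ap , []
  AllPairs-++⁻ (x ∷ xs) (a ∷ ap) =
    let p , q , r = AllPairs-++⁻ xs ap
    in Allₚ.++⁻ˡ xs a ∷ p , q , Allₚ.++⁻ʳ xs a ∷ r

  AllPairs-rotate : (∀ {x y} → R x y → R y x) →
    ∀ xs {ys} → AllPairs R (xs ++ ys) → AllPairs R (ys ++ xs)
  AllPairs-rotate R-sym xs ap =
    let p , q , r = AllPairs-++⁻ xs ap
    in APₚ.++⁺ q p (All.tabulate λ y∈ → All.tabulate λ x∈ → R-sym (All.lookup (All.lookup r x∈) y∈))

  AllPairs-resp-⊆ : ∀ {xs ys} → xs ⊆ ys → AllPairs R ys → AllPairs R xs
  AllPairs-resp-⊆ []            []        = []
  AllPairs-resp-⊆ (_ ∷ʳ sub)    (_ ∷ ap)  = AllPairs-resp-⊆ sub ap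
  AllPairs-resp-⊆ (refl ∷ sub)  (a ∷ ap)  = All-resp-⊆ sub a ∷ AllPairs-resp-⊆ sub ap

module _ {A : Set} where

  ∈-─ : ∀ {x y : A} {ys} (x∈ys : x ∈ ys) → y ∈ ys → y ≢ x → y ∈ (ys ─ x∈ys)
  ∈-─ (here refl) (here refl) y≢x = ⊥-elim (y≢x refl)
  ∈-─ (here refl) (there y∈)  _   = y∈
  ∈-─ (there x∈)  (here refl) _   = here refl
  ∈-─ (there x∈)  (there y∈)  y≢x = there (∈-─ x∈ y∈ y≢x)

  Unique-length-≤ : ∀ {xs ys : List A} → Unique xs → (∀ {x} → x ∈ xs → x ∈ ys) → length xs ≤ length ys
  Unique-length-≤ {[]}     _            _     = z≤n
  Unique-length-≤ {x ∷ xs} {ys} (x∉xs ∷ u) xs⊆ys = begin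
    suc (length xs)          ≤⟨ s≤s (Unique-length-≤ u (λ y∈ → ∈-─ x∈ys (xs⊆ys (there y∈)) (x≢ y∈))) ⟩
    suc (length (ys ─ x∈ys)) ≡⟨ sym (length-removeAt′ ys (index x∈ys)) ⟩
    length ys                ∎
    where
    open ≤-Reasoning
    x∈ys = xs⊆ys (here refl)
    x≢ : ∀ {y} → y ∈ xs → y ≢ x
    x≢ y∈ y≡x = All.lookup x∉xs y∈ (sym y≡x)

  Unique-length-≡ : ∀ {xs ys : List A} → Unique xs → Unique ys →
    (∀ {x} → x ∈ xs → x ∈ ys) → (∀ {x} → x ∈ ys → x ∈ xs) → length xs ≡ length ys
  Unique-length-≡ u u′ xs⊆ys ys⊆xs = ≤-antisym (Unique-length-≤ u xs⊆ys) (Unique-length-≤ u′ ys⊆xs)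

length-concatMap : ∀ {A B : Set} (f : A → List B) xs → length (concatMap f xs) ≡ sum (map (length ∘ f) xs)
length-concatMap f []       = refl
length-concatMap f (x ∷ xs) = trans (length-++ (f x)) (cong (length (f x) +_) (length-concatMap f xs))

last-++ : ∀ {A : Set} (xs : List A) {y ys} → last (xs ++ y ∷ ys) ≡ last (y ∷ ys)
last-++ []           = refl
last-++ (x ∷ [])     = refl
last-++ (x ∷ x′ ∷ xs) = last-++ (x′ ∷ xs)

T-not : ∀ {b} → T (not b) ⇔ (¬ T b)
T-not {true}  = mk⇔ (λ ()) (λ ¬t → ¬t _)
T-not {false} = mk⇔ (λ _ ()) _

T-==ᵇ : ∀ {a b} → T (a ==ᵇ b) ⇔ (T a ⇔ T b)
T-==ᵇ {true}  {true}  = mk⇔ (λ _ → mk⇔ _ _) _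
T-==ᵇ {true}  {false} = mk⇔ (λ ()) (λ e → Equivalence.to e _)
T-==ᵇ {false} {true}  = mk⇔ (λ ()) (λ e → Equivalence.from e _)
T-==ᵇ {false} {false} = mk⇔ (λ _ → mk⇔ (λ ()) (λ ())) _

T-<ᵇ : ∀ {m n} → T (m <ᵇ n) ⇔ m < n
T-<ᵇ {m} {n} = mk⇔ (<ᵇ⇒< m n) <⇒<ᵇ

T-==ᵇ-<ᵇ : ∀ {x x′ y y′} → T ((x <ᵇ x′) ==ᵇ (y <ᵇ y′)) ⇔ (x < x′ ⇔ y < y′)
T-==ᵇ-<ᵇ = mk⇔ (λ t → T-<ᵇ ⇔-∘ (Equivalence.to T-==ᵇ t ⇔-∘ ⇔-sym T-<ᵇ))
               (λ e → Equivalence.from T-==ᵇ (⇔-sym T-<ᵇ ⇔-∘ (e ⇔-∘ T-<ᵇ)))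

-- For literals: the hidden argument has type T true = ⊤ and is found by eta.
<-by-eval : ∀ {m n} {_ : T (m <ᵇ n)} → m < n
<-by-eval {m} {n} {t} = <ᵇ⇒< m n t

Increasing : List ℕ → Set
Increasing = AllPairs _<_

Above : List ℕ → List ℕ → Set
Above A B = All (λ a → All (_< a) B) A

range : ℕ → ℕ → List ℕ
range lo zero    = []
range lo (suc n) = lo ∷ range (suc lo) n

range-length : ∀ lo n → length (range lo n) ≡ n
range-length lo zero    = refl
range-length lo (suc n) = cong suc (range-length (suc lo) n)

∈-range⁻ : ∀ lo n {x} → x ∈ range lo n → lo ≤ x × x < lo + n
∈-range⁻ lo (suc n) (here refl) = ≤-refl , m<m+n lo (s≤s z≤n)
∈-range⁻ lo (suc n) {x} (there x∈) =
  let lo<x , x<lo+n = ∈-range⁻ (suc lo) n x∈ in <⇒≤ lo<x , subst (x <_) (sym (+-suc lo n)) x<lo+n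

∈-range⁺ : ∀ lo n {x} → lo ≤ x → x < lo + n → x ∈ range lo n
∈-range⁺ lo zero    lo≤x x<lo = ⊥-elim (<-irrefl refl (<-≤-trans (subst (_ <_) (+-identityʳ lo) x<lo) lo≤x))
∈-range⁺ lo (suc n) {x} lo≤x x<lo+n with lo ≟ x
... | yes refl = here refl
... | no lo≢x  = there (∈-range⁺ (suc lo) n (≤∧≢⇒< lo≤x lo≢x) (subst (x <_) (+-suc lo n) x<lo+n))

range-increasing : ∀ lo n → Increasing (range lo n)
range-increasing lo zero    = []
range-increasing lo (suc n) = All.tabulate (proj₁ ∘ ∈-range⁻ (suc lo) n) ∷ range-increasing (suc lo) n

last-range : ∀ lo n → last (range lo (suc n)) ≡ just (lo + n)
last-range lo zero    = cong just (sym (+-identityʳ lo))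
last-range lo (suc n) = trans (last-range (suc lo) n) (cong just (sym (+-suc lo n)))

increasing-head-bound : ∀ {b x xs} → Increasing (x ∷ xs) → All (_< b) (x ∷ xs) → x + length xs < b
increasing-head-bound {x = x} {[]}     _                  (x<b ∷ []) = subst (_< _) (sym (+-identityʳ x)) x<b
increasing-head-bound {x = x} {y ∷ ys} ((x<y ∷ _) ∷ inc)  (_ ∷ ys<b) = begin-strict
  x + suc (length ys) ≡⟨ +-suc x (length ys) ⟩
  suc x + length ys   ≤⟨ +-monoˡ-≤ (length ys) x<y ⟩
  y + length ys       <⟨ increasing-head-bound inc ys<b ⟩
  _                   ∎
  where open ≤-Reasoning

increasing⇒range : ∀ lo xs → Increasing xs → All (λ x → lo ≤ x × x < lo + length xs) xs →
  xs ≡ range lo (length xs)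
increasing⇒range lo []       _               _                     = refl
increasing⇒range lo (x ∷ xs) inc@(x<xs ∷ inc′) bounds@((lo≤x , _) ∷ bounds′) =
  cong₂ _∷_ x≡lo (increasing⇒range (suc lo) xs inc′ (All.zipWith shift (x<xs , bounds′)))
  where
  x≡lo : x ≡ lo
  x≡lo = ≤-antisym (+-cancelʳ-≤ (length xs) x lo
           (s≤s⁻¹ (subst (x + length xs <_) (+-suc lo (length xs))
                         (increasing-head-bound inc (All.map proj₂ bounds)))))
           lo≤x
  shift : ∀ {y} → x < y × lo ≤ y × y < lo + suc (length xs) → suc lo ≤ y × y < suc lo + length xs
  shift {y} (x<y , _ , y<) = subst (_< y) x≡lo x<y , subst (y <_) (+-suc lo (length xs)) y<

Unique-bounded : ∀ {xs} lo n → Unique xs → All (λ x → lo ≤ x × x < lo + n) xs → length xs ≤ n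
Unique-bounded lo n u bounds =
  subst (_ ≤_) (range-length lo n)
    (Unique-length-≤ u (λ x∈ → let lo≤x , x<lo+n = All.lookup bounds x∈ in ∈-range⁺ lo n lo≤x x<lo+n))

unique-pairs⇒increasing : ∀ {xs} → Unique xs → (∀ {x y} → x ∷ y ∷ [] ⊆ xs → ¬ y < x) → Increasing xs
unique-pairs⇒increasing {[]}     _              _        = []
unique-pairs⇒increasing {x ∷ xs} (x∉xs ∷ u) no-descent =
  All.zipWith (λ (x≢y , ¬y<x) → ≤∧≢⇒< (≮⇒≥ ¬y<x) x≢y)
              (x∉xs , All.tabulate (λ y∈ → no-descent (refl ∷ from∈ y∈))) ∷
  unique-pairs⇒increasing u (λ sub → no-descent (x ∷ʳ sub))

shift-unshift : ∀ c xs → All (c ≤_) xs → map (c +_) (map (_∸ c) xs) ≡ xs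
shift-unshift c []       []               = refl
shift-unshift c (x ∷ xs) (c≤x ∷ c≤xs) = cong₂ _∷_ (m+[n∸m]≡n c≤x) (shift-unshift c xs c≤xs)

-- Order-isomorphic occurrences

Agree : ℕ × ℕ → ℕ × ℕ → Set
Agree (x , y) (x′ , y′) = (x < x′ ⇔ y < y′) × (x′ < x ⇔ y′ < y)

Agree-sym : ∀ {p q} → Agree p q → Agree q p
Agree-sym (up , down) = down , up

agree-< : ∀ {x y x′ y′} → x < x′ → y < y′ → Agree (x , y) (x′ , y′)
agree-< x<x′ y<y′ =
  mk⇔ (λ _ → y<y′) (λ _ → x<x′) ,
  mk⇔ (λ x′<x → ⊥-elim (<-asym x<x′ x′<x)) (λ y′<y → ⊥-elim (<-asym y<y′ y′<y))

agree-> : ∀ {x y x′ y′} → x′ < x → y′ < y → Agree (x , y) (x′ , y′)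
agree-> x′<x y′<y = Agree-sym (agree-< x′<x y′<y)

agree-↑ : ∀ {x y x′ y′} → Agree (x , y) (x′ , y′) → y < y′ → x < x′
agree-↑ (up , _) = Equivalence.from up

agree-↓ : ∀ {x y x′ y′} → Agree (x , y) (x′ , y′) → y′ < y → x′ < x
agree-↓ (_ , down) = Equivalence.from down

agree-increasing : ∀ zs → AllPairs Agree zs → Increasing (map proj₂ zs) → Increasing (map proj₁ zs)
agree-increasing zs ap inc = APₚ.map⁺ (AllPairs.zipWith (λ (h , y<y′) → agree-↑ h y<y′) (ap , APₚ.map⁻ inc))

agree-below : ∀ {x y} zs → All (Agree (x , y)) zs → All (_< y) (map proj₂ zs) → All (_< x) (map proj₁ zs)
agree-below zs hs below = Allₚ.map⁺ (All.zipWith (λ (h , y′<y) → agree-↓ h y′<y) (hs , Allₚ.map⁻ below))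

pairUp : ∀ xs ys → length xs ≡ length ys → Increasing xs → Increasing ys →
  Σ[ zs ∈ List (ℕ × ℕ) ] map proj₁ zs ≡ xs × map proj₂ zs ≡ ys × AllPairs Agree zs
pairUp []       []       _   _            _            = [] , refl , refl , []
pairUp (x ∷ xs) (y ∷ ys) len (x<xs ∷ inc) (y<ys ∷ inc′) with pairUp xs ys (suc-injective len) inc inc′
... | zs , refl , refl , ap =
  (x , y) ∷ zs , refl , refl ,
  All.zipWith (λ (x<x′ , y<y′) → agree-< x<x′ y<y′) (Allₚ.map⁻ x<xs , Allₚ.map⁻ y<ys) ∷ ap

T-agree : ∀ x y x′ y′ →
  T (((x <ᵇ x′) ==ᵇ (y <ᵇ y′)) ∧ ((x′ <ᵇ x) ==ᵇ (y′ <ᵇ y))) ⇔ Agree (x , y) (x′ , y′)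
T-agree x y x′ y′ = mk⇔
  (λ t → let u , d = Equivalence.to T-∧ t
         in Equivalence.to T-==ᵇ-<ᵇ u , Equivalence.to T-==ᵇ-<ᵇ d)
  (λ (u , d) → Equivalence.from T-∧ (Equivalence.from T-==ᵇ-<ᵇ u , Equivalence.from T-==ᵇ-<ᵇ d))

ordIso-sound : ∀ xs ys → T (ordIso xs ys) →
  Σ[ zs ∈ List (ℕ × ℕ) ] map proj₁ zs ≡ xs × map proj₂ zs ≡ ys × AllPairs Agree zs
ordIso-sound []       []       _ = [] , refl , refl , []
ordIso-sound (x ∷ xs) (y ∷ ys) t with Equivalence.to T-∧ t
... | heads , tails with ordIso-sound xs ys tails
... | zs , refl , refl , ap =
  (x , y) ∷ zs , refl , refl ,
  All.map (λ { {x′ , y′} → Equivalence.to (T-agree x y x′ y′) })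
          (subst (All _) (zip-unzip zs) (Allₚ.all⁺ _ (zip (map proj₁ zs) (map proj₂ zs)) heads)) ∷ ap

ordIso-complete : ∀ zs → AllPairs Agree zs → T (ordIso (map proj₁ zs) (map proj₂ zs))
ordIso-complete []             []        = _
ordIso-complete ((x , y) ∷ zs) (a ∷ ap)  = Equivalence.from T-∧
  ( Allₚ.all⁻ _ (subst (All _) (sym (zip-unzip zs))
      (All.map (λ { {x′ , y′} → Equivalence.from (T-agree x y x′ y′) }) a))
  , ordIso-complete zs ap)

Occurrence : List ℕ → List ℕ → Set
Occurrence π σ =
  Σ[ zs ∈ List (ℕ × ℕ) ] map proj₁ zs ⊆ σ × map proj₂ zs ≡ π × AllPairs Agree zs

containsLin-sound : ∀ σ π → T (containsLin σ π) → Occurrence π σ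
containsLin-sound σ π t with find (any⁻ _ (subseqs σ) t)
... | s , s∈ , iso with ordIso-sound s π iso
... | zs , refl , refl , ap = zs , ∈-subseqs⁻ σ s∈ , refl , ap

containsLin-complete : ∀ σ π → Occurrence π σ → T (containsLin σ π)
containsLin-complete σ π (zs , sub , refl , ap) =
  any⁺ _ (lose (∈-subseqs⁺ sub) (ordIso-complete zs ap))

rotate : ℕ → List ℕ → List ℕ
rotate i σ = drop i σ ++ take i σ

containsCirc-sound : ∀ σ π → T (containsCirc σ π) →
  Σ[ i ∈ ℕ ] i < length σ × T (containsLin (rotate i σ) π)
containsCirc-sound σ π t with find (any⁻ _ (rotations σ) t)
... | r , r∈ , c with ∈-map⁻ _ r∈
... | i , i∈ , refl = i , ∈-upTo⁻ i∈ , c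

containsCirc-complete : ∀ σ π i → i < length σ → T (containsLin (rotate i σ) π) → T (containsCirc σ π)
containsCirc-complete σ π i i<n c = any⁺ _ (lose (∈-map⁺ (λ i → rotate i σ) (∈-upTo⁺ i<n)) c)

-- An occurrence z₁ ++ z₂ of π in a rotation of σ, read back in σ itself,
-- is the subsequence z₂ ++ z₁.
CircOccurrence : List ℕ → List ℕ → Set
CircOccurrence π σ = Σ[ z₁ ∈ List (ℕ × ℕ) ] Σ[ z₂ ∈ List (ℕ × ℕ) ]
  map proj₁ (z₂ ++ z₁) ⊆ σ × map proj₂ (z₁ ++ z₂) ≡ π × AllPairs Agree (z₂ ++ z₁)

circOccurrence-sound : ∀ σ π → T (containsCirc σ π) → CircOccurrence π σ
circOccurrence-sound σ π t with containsCirc-sound σ π t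
... | i , _ , c with containsLin-sound (rotate i σ) π c
... | zs , sub , refl , ap with map-⊆-++⁻ proj₁ zs (drop i σ) (take i σ) sub
... | z₁ , z₂ , refl , sub₁ , sub₂ =
  z₁ , z₂ ,
  subst₂ _⊆_ (sym (map-++ proj₁ z₂ z₁)) (take++drop≡id i σ) (++⁺ sub₂ sub₁) ,
  refl , AllPairs-rotate Agree-sym z₁ ap

circOccurrence-complete : ∀ σ π → CircOccurrence π σ → 0 < length σ → T (containsCirc σ π)
circOccurrence-complete σ π ([] , z₂ , sub , refl , ap) 0<n =
  containsCirc-complete σ π 0 0<n (containsLin-complete _ π
    (z₂ , subst₂ (λ zs τ → map proj₁ zs ⊆ τ) (++-identityʳ z₂) (sym (++-identityʳ σ)) sub , refl ,
     subst (AllPairs Agree) (++-identityʳ z₂) ap))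
circOccurrence-complete σ π (z ∷ z₁ , z₂ , sub , refl , ap) _
  with ++-⊆⁻ (map proj₁ z₂) (map proj₁ (z ∷ z₁)) (subst (_⊆ σ) (map-++ proj₁ z₂ (z ∷ z₁)) sub)
... | i , sub₂ , sub₁ =
  containsCirc-complete σ π i (∷-⊆-drop⇒< i σ sub₁) (containsLin-complete _ π
    (z ∷ z₁ ++ z₂ , subst (_⊆ rotate i σ) (sym (map-++ proj₁ (z ∷ z₁) z₂)) (++⁺ sub₁ sub₂) , refl ,
     AllPairs-rotate Agree-sym z₂ ap))

-- Linear patterns

Has : (List ℕ → Set) → List ℕ → Set
Has S w = Σ[ s ∈ List ℕ ] s ⊆ w × S s

Shape213 : List ℕ → Set
Shape213 (a ∷ b ∷ c ∷ []) = b < a × a < c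
Shape213 _                = ⊥

Shape4132 : List ℕ → Set
Shape4132 (a ∷ b ∷ c ∷ d ∷ []) = b < d × d < c × c < a
Shape4132 _                    = ⊥

-- τ_k without its leading 1: an entry followed by k increasing smaller ones.
TauTail : ℕ → List ℕ → Set
TauTail k []      = ⊥
TauTail k (t ∷ r) = length r ≡ k × Increasing r × All (_< t) r

Has-⊆ : ∀ {S w w′} → w ⊆ w′ → Has S w → Has S w′
Has-⊆ w⊆w′ (s , s⊆w , shape) = s , ⊆-trans s⊆w w⊆w′ , shape

OrderEmbedding : (ℕ → ℕ) → Set
OrderEmbedding f = ∀ {x y} → x < y ⇔ f x < f y

OrderInvariant : (List ℕ → Set) → Set
OrderInvariant S = ∀ {f} → OrderEmbedding f → ∀ {s} → S s ⇔ S (map f s)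

+-orderEmbedding : ∀ c → OrderEmbedding (c +_)
+-orderEmbedding c = mk⇔ (+-monoʳ-< c) (+-cancelˡ-< c _ _)

shape213-invariant : OrderInvariant Shape213
shape213-invariant e {a ∷ b ∷ c ∷ []} =
  mk⇔ (λ (p , q) → to e p , to e q) (λ (p , q) → from e p , from e q)
  where open Equivalence
shape213-invariant e {[]}                  = mk⇔ (λ ()) (λ ())
shape213-invariant e {_ ∷ []}              = mk⇔ (λ ()) (λ ())
shape213-invariant e {_ ∷ _ ∷ []}          = mk⇔ (λ ()) (λ ())
shape213-invariant e {_ ∷ _ ∷ _ ∷ _ ∷ _}   = mk⇔ (λ ()) (λ ())

shape4132-invariant : OrderInvariant Shape4132
shape4132-invariant e {a ∷ b ∷ c ∷ d ∷ []} =
  mk⇔ (λ (p , q , r) → to e p , to e q , to e r) (λ (p , q , r) → from e p , from e q , from e r)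
  where open Equivalence
shape4132-invariant e {[]}                    = mk⇔ (λ ()) (λ ())
shape4132-invariant e {_ ∷ []}                = mk⇔ (λ ()) (λ ())
shape4132-invariant e {_ ∷ _ ∷ []}            = mk⇔ (λ ()) (λ ())
shape4132-invariant e {_ ∷ _ ∷ _ ∷ []}        = mk⇔ (λ ()) (λ ())
shape4132-invariant e {_ ∷ _ ∷ _ ∷ _ ∷ _ ∷ _} = mk⇔ (λ ()) (λ ())

tauTail-invariant : ∀ k → OrderInvariant (TauTail k)
tauTail-invariant k e {[]}        = mk⇔ (λ ()) (λ ())
tauTail-invariant k {f} e {t ∷ r} = mk⇔
  (λ (len , inc , below) →
     trans (length-map f r) len , APₚ.map⁺ (AllPairs.map (to e) inc) , Allₚ.map⁺ (All.map (to e) below))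
  (λ (len , inc , below) →
     trans (sym (length-map f r)) len , AllPairs.map (from e) (APₚ.map⁻ inc) ,
     All.map (from e) (Allₚ.map⁻ below))
  where open Equivalence

Has-map : ∀ {S f} → OrderInvariant S → OrderEmbedding f → ∀ w → Has S w ⇔ Has S (map f w)
Has-map {S} {f} inv e w = mk⇔
  (λ (s , s⊆w , shape) → map f s , map⁺ f s⊆w , Equivalence.to (inv e) shape)
  (λ (s , s⊆fw , shape) → let s′ , s′⊆w , eq = ⊆-map⁻ f w s⊆fw
                          in s′ , s′⊆w , Equivalence.from (inv e) (subst S eq shape))

HeadNotMinimal : (List ℕ → Set) → Set
HeadNotMinimal S = ∀ {x s} → S (x ∷ s) → All (x <_) s → ⊥

Has-∷-min : ∀ {S} → HeadNotMinimal S → ∀ {x w} → All (x <_) w → Has S (x ∷ w) → Has S w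
Has-∷-min hnm x<w (s     , _ ∷ʳ s⊆w   , shape) = s , s⊆w , shape
Has-∷-min hnm x<w (_ ∷ s , refl ∷ s⊆w , shape) = ⊥-elim (hnm shape (All-resp-⊆ s⊆w x<w))

shape213-headNotMinimal : HeadNotMinimal Shape213
shape213-headNotMinimal {s = _ ∷ _ ∷ []} (b<a , _) (a<b ∷ _) = <-asym b<a a<b

shape4132-headNotMinimal : HeadNotMinimal Shape4132
shape4132-headNotMinimal {s = _ ∷ _ ∷ _ ∷ []} (_ , _ , c<a) (_ ∷ a<c ∷ _) = <-asym c<a a<c

tauTail-headNotMinimal : ∀ {k} → 1 ≤ k → HeadNotMinimal (TauTail k)
tauTail-headNotMinimal 1≤k {s = []}    (refl , _)        _         = <-irrefl refl 1≤k
tauTail-headNotMinimal _   {s = _ ∷ _} (_ , _ , y<t ∷ _) (t<y ∷ _) = <-asym y<t t<y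

Has-++-above : ∀ {S n} →
  (∀ s₁ s₂ → S (s₁ ++ s₂) → Above s₁ s₂ → Increasing s₂ → length s₂ < n → s₂ ≡ []) →
  ∀ {A B} → Above A B → Increasing B → length B < n → Has S (A ++ B) → Has S A
Has-++-above {S} no-straddle {A} {B} A>B inc |B|<n (s , s⊆AB , shape)
  with ⊆-++⁻ A B s⊆AB
... | s₁ , s₂ , refl , s₁⊆A , s₂⊆B
  with no-straddle s₁ s₂ shape (All-resp-⊆ s₁⊆A (All.map (All-resp-⊆ s₂⊆B) A>B))
                               (AllPairs-resp-⊆ s₂⊆B inc) (≤-<-trans (length-mono-≤ s₂⊆B) |B|<n)
... | refl = s₁ , s₁⊆A , subst S (++-identityʳ s₁) shape

shape213-no-straddle : ∀ s₁ s₂ → Shape213 (s₁ ++ s₂) → Above s₁ s₂ → Increasing s₂ → s₂ ≡ []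
shape213-no-straddle _ [] _ _ _ = refl
shape213-no-straddle [] (_ ∷ _ ∷ _ ∷ []) (b<a , _) _ ((a<b ∷ _) ∷ _) = ⊥-elim (<-asym b<a a<b)
shape213-no-straddle (_ ∷ []) (_ ∷ _ ∷ []) (_ , a<c) ((_ ∷ c<a ∷ []) ∷ []) _ = ⊥-elim (<-asym a<c c<a)
shape213-no-straddle (_ ∷ _ ∷ []) (_ ∷ []) (_ , a<c) ((c<a ∷ []) ∷ _) _ = ⊥-elim (<-asym a<c c<a)
shape213-no-straddle (_ ∷ _ ∷ [])        (_ ∷ _ ∷ _) () _ _
shape213-no-straddle (_ ∷ _ ∷ _ ∷ [])    (_ ∷ _)     () _ _
shape213-no-straddle (_ ∷ _ ∷ _ ∷ _ ∷ _) (_ ∷ _)     () _ _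

shape4132-no-straddle : ∀ s₁ s₂ → Shape4132 (s₁ ++ s₂) → Above s₁ s₂ → Increasing s₂ → s₂ ≡ []
shape4132-no-straddle _ [] _ _ _ = refl
shape4132-no-straddle [] (_ ∷ _ ∷ _ ∷ _ ∷ []) (_ , d<c , _) _ (_ ∷ _ ∷ (c<d ∷ []) ∷ [] ∷ []) =
  ⊥-elim (<-asym d<c c<d)
shape4132-no-straddle (_ ∷ []) (_ ∷ _ ∷ _ ∷ []) (_ , d<c , _) _ (_ ∷ (c<d ∷ []) ∷ [] ∷ []) =
  ⊥-elim (<-asym d<c c<d)
shape4132-no-straddle (_ ∷ _ ∷ []) (_ ∷ _ ∷ []) (_ , d<c , _) _ ((c<d ∷ []) ∷ [] ∷ []) =
  ⊥-elim (<-asym d<c c<d)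
shape4132-no-straddle (_ ∷ _ ∷ _ ∷ []) (_ ∷ []) (b<d , _) (_ ∷ (d<b ∷ []) ∷ _) _ =
  ⊥-elim (<-asym b<d d<b)
shape4132-no-straddle (_ ∷ [])                (_ ∷ _ ∷ _ ∷ _ ∷ _) () _ _
shape4132-no-straddle (_ ∷ _ ∷ [])            (_ ∷ _ ∷ _ ∷ _)     () _ _
shape4132-no-straddle (_ ∷ _ ∷ _ ∷ [])        (_ ∷ _ ∷ _)         () _ _
shape4132-no-straddle (_ ∷ _ ∷ _ ∷ _ ∷ [])    (_ ∷ _)             () _ _
shape4132-no-straddle (_ ∷ _ ∷ _ ∷ _ ∷ _ ∷ _) (_ ∷ _)             () _ _

tauTail-no-straddle : ∀ {k} → 1 ≤ k → ∀ s₁ s₂ → TauTail k (s₁ ++ s₂) → Above s₁ s₂ → Increasing s₂ →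
  length s₂ < k → s₂ ≡ []
tauTail-no-straddle _ _ [] _ _ _ _ = refl
tauTail-no-straddle 1≤k [] (_ ∷ []) (refl , _) _ _ _ = ⊥-elim (<-irrefl refl 1≤k)
tauTail-no-straddle _ [] (_ ∷ _ ∷ _) (_ , _ , y<t ∷ _) _ ((t<y ∷ _) ∷ _) _ = ⊥-elim (<-asym y<t t<y)
tauTail-no-straddle _ (_ ∷ []) (_ ∷ _) (refl , _) _ _ |r|<k = ⊥-elim (<-irrefl refl |r|<k)
tauTail-no-straddle _ (_ ∷ y ∷ s₁) (z ∷ _) (_ , y<r ∷ _ , _) (_ ∷ (z<y ∷ _) ∷ _) _ _ =
  ⊥-elim (<-asym z<y (All.head (Allₚ.++⁻ʳ s₁ y<r)))

-- Circular patterns of a permutation starting with its minimum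

tauValues : ℕ → List ℕ
tauValues k = map (2 +_) (upTo k)

tauValues-increasing : ∀ k → Increasing (tauValues k)
tauValues-increasing k = APₚ.map⁺ (AllPairs.map (+-monoʳ-< 2) (APₚ.applyUpTo⁺₁ (λ i → i) k (λ i<j _ → i<j)))

tauValues-bounds : ∀ k → All (λ y → 2 ≤ y × y < k + 2) (tauValues k)
tauValues-bounds k = Allₚ.map⁺ (All.tabulate λ {i} i∈ →
  m≤m+n 2 i , subst (2 + i <_) (+-comm 2 k) (+-monoʳ-< 2 (∈-upTo⁻ i∈)))

tauValues-length : ∀ k → length (tauValues k) ≡ k
tauValues-length k = trans (length-map (2 +_) (upTo k)) (length-upTo k)

has213⇒contains1324 : ∀ {w} → All (0 <_) w → Has Shape213 w → T (containsCirc (0 ∷ w) p1324)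
has213⇒contains1324 w>0 (a ∷ b ∷ c ∷ [] , sub , b<a , a<c) with All-resp-⊆ sub w>0
... | 0<a ∷ 0<b ∷ 0<c ∷ [] =
  circOccurrence-complete (0 ∷ _) p1324
    ((0 , 1) ∷ (a , 3) ∷ (b , 2) ∷ (c , 4) ∷ [] , [] , refl ∷ sub , refl ,
     (agree-< 0<a <-by-eval ∷ agree-< 0<b <-by-eval ∷ agree-< 0<c <-by-eval ∷ []) ∷
     (agree-> b<a <-by-eval ∷ agree-< a<c <-by-eval ∷ []) ∷
     (agree-< (<-trans b<a a<c) <-by-eval ∷ []) ∷ [] ∷ [])
    (s≤s z≤n)

has4132⇒contains1324 : ∀ {w} → Has Shape4132 w → T (containsCirc (0 ∷ w) p1324)
has4132⇒contains1324 (a ∷ b ∷ c ∷ d ∷ [] , sub , b<d , d<c , c<a) =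
  circOccurrence-complete (0 ∷ _) p1324
    ((b , 1) ∷ (c , 3) ∷ (d , 2) ∷ [] , (a , 4) ∷ [] , 0 ∷ʳ sub , refl ,
     (agree-> b<a <-by-eval ∷ agree-> c<a <-by-eval ∷ agree-> d<a <-by-eval ∷ []) ∷
     (agree-< (<-trans b<d d<c) <-by-eval ∷ agree-< b<d <-by-eval ∷ []) ∷
     (agree-> d<c <-by-eval ∷ []) ∷ [] ∷ [])
    (s≤s z≤n)
  where
  d<a = <-trans d<c c<a
  b<a = <-trans b<d d<a

hasTauTail⇒containsTau : ∀ {k w} → All (0 <_) w → Has (TauTail k) w → T (containsCirc (0 ∷ w) (tau k))
hasTauTail⇒containsTau {k} w>0 (t ∷ r , sub , len , inc , r<t)
  with pairUp r (tauValues k) (trans len (sym (tauValues-length k))) inc (tauValues-increasing k)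
... | zs , refl , eq , ap =
  circOccurrence-complete (0 ∷ _) (tau k)
    ((0 , 1) ∷ (t , k + 2) ∷ zs , [] , refl ∷ sub ,
     cong (λ ys → 1 ∷ k + 2 ∷ ys) (trans (cong (map proj₂) (++-identityʳ zs)) eq) ,
     (agree-< 0<t (m≤n+m 2 k) ∷ pairs (λ 0<x (2≤y , _) → agree-< 0<x 2≤y) 0<r) ∷
     pairs (λ x<t (_ , y<k+2) → agree-> x<t y<k+2) r<t ∷ ap)
    (s≤s z≤n)
  where
  0<t∷r = All-resp-⊆ sub w>0
  0<t = All.head 0<t∷r
  0<r = All.tail 0<t∷r
  bounds = subst (All (λ y → 2 ≤ y × y < k + 2)) (sym eq) (tauValues-bounds k)
  pairs : ∀ {P : ℕ → Set} {p} → (∀ {x y} → P x → 2 ≤ y × y < k + 2 → Agree p (x , y)) →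
          All P (map proj₁ zs) → All (Agree p) zs
  pairs f ps = All.zipWith (λ (px , qy) → f px qy) (Allₚ.map⁻ ps , Allₚ.map⁻ bounds)

⊆-drop-0 : ∀ {a x xs w} → a < x → x ∷ xs ⊆ 0 ∷ w → x ∷ xs ⊆ w
⊆-drop-0 a<x = ∷ʳ⁻ (>⇒≢ (≤-<-trans z≤n a<x))

contains1324⇒ : ∀ {w} → T (containsCirc (0 ∷ w) p1324) → Has Shape213 w ⊎ Has Shape4132 w
contains1324⇒ {w} t = fromRotation (circOccurrence-sound (0 ∷ w) p1324 t)
  where
  fromRotation : CircOccurrence p1324 (0 ∷ w) → Has Shape213 w ⊎ Has Shape4132 w
  fromRotation ([] , (a , _) ∷ (b , _) ∷ (c , _) ∷ (d , _) ∷ [] , sub , refl , _ ∷ (hbc ∷ hbd ∷ []) ∷ _) =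
    inj₁ (b ∷ c ∷ d ∷ [] , ∷⁻ sub , agree-↓ hbc <-by-eval , agree-↑ hbd <-by-eval)
  fromRotation ((a , _) ∷ (b , _) ∷ (c , _) ∷ (d , _) ∷ [] , [] , sub , refl , _ ∷ (hbc ∷ hbd ∷ []) ∷ _) =
    inj₁ (b ∷ c ∷ d ∷ [] , ∷⁻ sub , agree-↓ hbc <-by-eval , agree-↑ hbd <-by-eval)
  fromRotation ((a , _) ∷ [] , (b , _) ∷ (c , _) ∷ (d , _) ∷ [] , sub , refl , (hbc ∷ hbd ∷ hba ∷ []) ∷ _) =
    inj₁ (b ∷ c ∷ d ∷ [] , ⊆-trans (refl ∷ refl ∷ refl ∷ a ∷ʳ []) (⊆-drop-0 (agree-↓ hba <-by-eval) sub) ,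
          agree-↓ hbc <-by-eval , agree-↑ hbd <-by-eval)
  fromRotation ((a , _) ∷ (b , _) ∷ [] , (c , _) ∷ (d , _) ∷ [] , sub , refl , (_ ∷ hca ∷ hcb ∷ []) ∷ _) =
    inj₁ (c ∷ a ∷ b ∷ [] , ⊆-trans (refl ∷ d ∷ʳ refl ∷ refl ∷ []) (⊆-drop-0 (agree-↓ hca <-by-eval) sub) ,
          agree-↓ hca <-by-eval , agree-↑ hcb <-by-eval)
  fromRotation ((a , _) ∷ (b , _) ∷ (c , _) ∷ [] , (d , _) ∷ [] , sub , refl ,
                (hda ∷ hdb ∷ _) ∷ (_ ∷ hac ∷ []) ∷ (hbc ∷ []) ∷ _) =
    inj₂ (d ∷ a ∷ b ∷ c ∷ [] , ⊆-drop-0 (agree-↓ hda <-by-eval) sub ,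
          agree-↑ hac <-by-eval , agree-↓ hbc <-by-eval , agree-↓ hdb <-by-eval)

tauTail-from : ∀ {k t w} z → map proj₂ z ≡ tauValues k → All (Agree (t , k + 2)) z → AllPairs Agree z →
  t ∷ map proj₁ z ⊆ w → Has (TauTail k) w
tauTail-from {k} {t} z eq t-z ap sub =
  t ∷ map proj₁ z , sub ,
  trans (length-map proj₁ z) (trans (sym (length-map proj₂ z)) (trans (cong length eq) (tauValues-length k))) ,
  agree-increasing z ap (subst Increasing (sym eq) (tauValues-increasing k)) ,
  agree-below z t-z (subst (All (_< k + 2)) (sym eq) (All.map proj₂ (tauValues-bounds k)))

containsTau⇒ : ∀ {k w} → T (containsCirc (0 ∷ w) (tau k)) → Has Shape213 w ⊎ Has (TauTail k) w
containsTau⇒ {k} {w} t = fromRotation (circOccurrence-sound (0 ∷ w) (tau k) t)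
  where
  fromUnrotated : ∀ z → map proj₂ z ≡ tau k → map proj₁ z ⊆ 0 ∷ w → AllPairs Agree z → Has (TauTail k) w
  fromUnrotated ((a , _) ∷ (t , _) ∷ z) eq sub (_ ∷ t-z ∷ ap) with ∷-injective (∷-injectiveʳ eq)
  ... | refl , eq′ = tauTail-from z eq′ t-z ap (∷⁻ sub)

  fromRotation : CircOccurrence (tau k) (0 ∷ w) → Has Shape213 w ⊎ Has (TauTail k) w
  fromRotation (z₁ , [] , sub , eq , ap) =
    inj₂ (fromUnrotated z₁ (subst (λ z → map proj₂ z ≡ tau k) (++-identityʳ z₁) eq) sub ap)
  fromRotation ([] , z₂@(_ ∷ _) , sub , eq , ap) =
    inj₂ (fromUnrotated z₂ eq (subst (λ z → map proj₁ z ⊆ 0 ∷ w) (++-identityʳ z₂) sub)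
                             (subst (AllPairs Agree) (++-identityʳ z₂) ap))
  fromRotation ((a , _) ∷ [] , (t , _) ∷ z , sub , eq , t-rest ∷ ap)
    with ∷-injective eq | Allₚ.++⁻ʳ z t-rest
  ... | refl , eq′ | hta ∷ [] with ∷-injective eq′
  ...   | refl , eq″ =
    inj₂ (tauTail-from z eq″ (Allₚ.++⁻ˡ z t-rest) (proj₁ (AllPairs-++⁻ z ap))
           (⊆-trans (refl ∷ subst (map proj₁ z ⊆_) (sym (map-++ proj₁ z _)) (++⁺ʳ _ ⊆-refl))
                    (⊆-drop-0 (agree-↓ hta (m≤n+m 2 k)) sub)))
  fromRotation ((a , _) ∷ (t , _) ∷ z₁ , (u , y) ∷ z₂ , sub , eq , u-rest ∷ _)
    with ∷-injective eq | Allₚ.++⁻ʳ z₂ u-rest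
  ... | refl , eq′ | hua ∷ hut ∷ _ with ∷-injective eq′
  ...   | refl , eq″ =
    inj₁ (u ∷ a ∷ t ∷ [] ,
          ⊆-trans (refl ∷ subst (a ∷ t ∷ [] ⊆_) (sym (map-++ proj₁ z₂ _))
                                (++⁺ˡ (map proj₁ z₂) (refl ∷ refl ∷ minimum _)))
                  (⊆-drop-0 a<u sub) ,
          a<u , agree-↑ hut y<k+2)
    where
    y∈ : y ∈ tauValues k
    y∈ = subst (y ∈_) eq″ (subst (y ∈_) (sym (map-++ proj₂ z₁ _)) (∈-++⁺ʳ (map proj₂ z₁) (here refl)))
    y-bounds = All.lookup (tauValues-bounds k) y∈
    y<k+2 = proj₂ y-bounds
    a<u = agree-↓ hua (proj₁ y-bounds)

-- Permutations and canonical rotations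

∈-allLists⁻ : ∀ n m {σ} → σ ∈ allLists n m → length σ ≡ m × All (_< n) σ
∈-allLists⁻ n zero    (here refl) = refl , []
∈-allLists⁻ n (suc m) σ∈ with find (∈-concatMap⁻ (λ x → map (x ∷_) (allLists n m)) {xs = upTo n} σ∈)
... | x , x∈ , σ∈′ with ∈-map⁻ (x ∷_) σ∈′
... | τ , τ∈ , refl = let len , τ<n = ∈-allLists⁻ n m τ∈ in cong suc len , ∈-upTo⁻ x∈ ∷ τ<n

∈-allLists⁺ : ∀ n m {σ} → length σ ≡ m → All (_< n) σ → σ ∈ allLists n m
∈-allLists⁺ n zero    {[]}    _   []          = here refl
∈-allLists⁺ n (suc m) {x ∷ σ} len (x<n ∷ σ<n) =
  ∈-concatMap⁺ (λ x → map (x ∷_) (allLists n m)) {xs = upTo n}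
    (lose (∈-upTo⁺ x<n) (∈-map⁺ (x ∷_) (∈-allLists⁺ n m (suc-injective len) σ<n)))

allLists-unique : ∀ n m → Unique (allLists n m)
allLists-unique n zero    = [] ∷ []
allLists-unique n (suc m) =
  Uniqueₚ.concat⁺ (Allₚ.map⁺ (All.tabulate λ _ → Uniqueₚ.map⁺ ∷-injectiveʳ (allLists-unique n m)))
                  (APₚ.map⁺ (AllPairs.map disjoint (Uniqueₚ.upTo⁺ n)))
  where
  disjoint : ∀ {x y} → x ≢ y → ∀ {σ} → ¬ (σ ∈ map (x ∷_) (allLists n m) × σ ∈ map (y ∷_) (allLists n m))
  disjoint x≢y (σ∈x , σ∈y) with ∈-map⁻ _ σ∈x | ∈-map⁻ _ σ∈y
  ... | _ , _ , refl | _ , _ , eq = x≢y (∷-injectiveˡ eq)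

distinct⇒Unique : ∀ σ → T (distinct σ) → Unique σ
distinct⇒Unique []      _ = []
distinct⇒Unique (x ∷ σ) t with Equivalence.to T-∧ t
... | fresh , rest =
  All.tabulate (λ y∈ x≡y → Equivalence.to T-not fresh (any⁺ _ (lose y∈ (≡⇒≡ᵇ x _ x≡y)))) ∷ distinct⇒Unique σ rest

Unique⇒distinct : ∀ σ → Unique σ → T (distinct σ)
Unique⇒distinct []      _            = _
Unique⇒distinct (x ∷ σ) (x∉σ ∷ u) = Equivalence.from T-∧
  (Equivalence.from T-not (λ t → let _ , y∈ , x≡ᵇy = find (any⁻ _ σ t) in All.lookup x∉σ y∈ (≡ᵇ⇒≡ x _ x≡ᵇy)) ,
   Unique⇒distinct σ u)

IsPerm : ℕ → List ℕ → Set
IsPerm m w = length w ≡ m × All (λ x → 1 ≤ x × x ≤ m) w × Unique w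

IsPerm-unshift : ∀ c {n} ys → length (map (c +_) ys) ≡ n → All (λ x → c < x × x ≤ c + n) (map (c +_) ys) →
  Unique (map (c +_) ys) → IsPerm n ys
IsPerm-unshift c ys len bounds u =
  trans (sym (length-map (c +_) ys)) len ,
  All.map (λ {y} (c<c+y , c+y≤c+n) → +-cancelˡ-< c 0 y (subst (_< c + y) (sym (+-identityʳ c)) c<c+y) ,
                                     +-cancelˡ-≤ c _ _ c+y≤c+n)
          (Allₚ.map⁻ bounds) ,
  Uniqueₚ.map⁻ u

Canonical : List ℕ → Bool
Canonical σ = distinct σ ∧ startsWithMin σ

canonical⇒IsPerm : ∀ m σ → length σ ≡ suc m → All (_< suc m) σ → T (Canonical σ) →
  Σ[ w ∈ List ℕ ] σ ≡ 0 ∷ w × IsPerm m w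
canonical⇒IsPerm m (x ∷ w) len (_ ∷ w≤m) t with Equivalence.to (T-∧ {distinct (x ∷ w)}) t
... | d , min with ≡ᵇ⇒≡ x 0 min
... | refl with distinct⇒Unique (0 ∷ w) d
... | 0∉w ∷ u =
  w , refl , suc-injective len , All.zipWith (λ (0≢y , y<) → n≢0⇒n>0 (≢-sym 0≢y) , s≤s⁻¹ y<) (0∉w , w≤m) , u

∈-circPerms⁻ : ∀ m {σ} → σ ∈ circPerms (suc m) → Σ[ w ∈ List ℕ ] σ ≡ 0 ∷ w × IsPerm m w
∈-circPerms⁻ m {σ} σ∈ with ∈-filter⁻ (T? ∘ Canonical) σ∈
... | σ∈′ , t = let len , σ<n = ∈-allLists⁻ (suc m) (suc m) σ∈′ in canonical⇒IsPerm m σ len σ<n t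

∈-circPerms⁺ : ∀ m {w} → IsPerm m w → 0 ∷ w ∈ circPerms (suc m)
∈-circPerms⁺ m {w} (len , bounds , u) =
  ∈-filter⁺ (T? ∘ Canonical)
    (∈-allLists⁺ (suc m) (suc m) (cong suc len) (s≤s z≤n ∷ All.map (λ (_ , y≤m) → s≤s y≤m) bounds))
    (Equivalence.from T-∧ (Unique⇒distinct (0 ∷ w) (All.map (λ (1≤y , _) → ≢-sym (>⇒≢ 1≤y)) bounds ∷ u) , _))

-- Avoiders of 213, 4132 and (k+1)12⋯k

module Avoiders (k : ℕ) (1≤k : 1 ≤ k) where

  Avoids : List ℕ → Set
  Avoids w = ¬ Has Shape213 w × ¬ Has Shape4132 w × ¬ Has (TauTail k) w

  Avoider : ℕ → List ℕ → Set
  Avoider m w = IsPerm m w × Avoids w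

  Avoids-⊆ : ∀ {xs ys} → xs ⊆ ys → Avoids ys → Avoids xs
  Avoids-⊆ sub (no213 , no4132 , noTau) = no213 ∘ Has-⊆ sub , no4132 ∘ Has-⊆ sub , noTau ∘ Has-⊆ sub

  Avoids-shift : ∀ c xs → Avoids xs ⇔ Avoids (map (c +_) xs)
  Avoids-shift c xs = mk⇔
    (λ (no213 , no4132 , noTau) →
       no213 ∘ from (shift shape213-invariant) , no4132 ∘ from (shift shape4132-invariant) ,
       noTau ∘ from (shift (tauTail-invariant k)))
    (λ (no213 , no4132 , noTau) →
       no213 ∘ to (shift shape213-invariant) , no4132 ∘ to (shift shape4132-invariant) ,
       noTau ∘ to (shift (tauTail-invariant k)))
    where
    open Equivalence
    shift : ∀ {S} → OrderInvariant S → Has S xs ⇔ Has S (map (c +_) xs)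
    shift inv = Has-map inv (+-orderEmbedding c) xs

  Avoids-∷-min : ∀ {x xs} → All (x <_) xs → Avoids xs → Avoids (x ∷ xs)
  Avoids-∷-min x<xs (no213 , no4132 , noTau) =
    no213 ∘ Has-∷-min shape213-headNotMinimal x<xs ,
    no4132 ∘ Has-∷-min shape4132-headNotMinimal x<xs ,
    noTau ∘ Has-∷-min (tauTail-headNotMinimal 1≤k) x<xs

  Avoids-++-above : ∀ {A B} → Above A B → Increasing B → length B < k → Avoids A → Avoids (A ++ B)
  Avoids-++-above A>B inc |B|<k (no213 , no4132 , noTau) =
    no213 ∘ Has-++-above (λ s₁ s₂ sh ab inc _ → shape213-no-straddle s₁ s₂ sh ab inc) A>B inc |B|<k ,
    no4132 ∘ Has-++-above (λ s₁ s₂ sh ab inc _ → shape4132-no-straddle s₁ s₂ sh ab inc) A>B inc |B|<k ,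
    noTau ∘ Has-++-above (tauTail-no-straddle 1≤k) A>B inc |B|<k

  avoidsAll⇔Avoids : ∀ {w} → All (0 <_) w → T (avoidsAll (p1324 ∷ tau k ∷ []) (0 ∷ w)) ⇔ Avoids w
  avoidsAll⇔Avoids {w} w>0 = mk⇔
    (λ t → let no1324 , noTau , _ = split t in
      (λ h → to T-not no1324 (has213⇒contains1324 w>0 h)) ,
      (λ h → to T-not no1324 (has4132⇒contains1324 h)) ,
      (λ h → to T-not noTau (hasTauTail⇒containsTau w>0 h)))
    (λ (no213 , no4132 , noTauTail) → from T-∧
      (from T-not ([ no213 , no4132 ]′ ∘ contains1324⇒) ,
       from T-∧ (from T-not ([ no213 , noTauTail ]′ ∘ containsTau⇒) , _)))
    where
    open Equivalence
    split : T (avoidsAll (p1324 ∷ tau k ∷ []) (0 ∷ w)) →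
      T (not (containsCirc (0 ∷ w) p1324)) × T (not (containsCirc (0 ∷ w) (tau k))) × T true
    split t = let a , b = to T-∧ t in a , to T-∧ b

  prependMin : List ℕ → List ℕ
  prependMin v = 1 ∷ map (1 +_) v

  appendRun : ℕ → List ℕ → List ℕ
  appendRun j u = map (suc j +_) u ++ range 1 (suc j)

  prependMin-avoider : ∀ {m v} → Avoider m v → Avoider (suc m) (prependMin v)
  prependMin-avoider {m} {v} ((len , bounds , u) , avoids) =
    (cong suc (trans (length-map (1 +_) v) len) ,
     (s≤s z≤n , s≤s z≤n) ∷ Allₚ.map⁺ (All.map (λ (_ , x≤m) → s≤s z≤n , s≤s x≤m) bounds) ,
     All.map <⇒≢ 1<v ∷ Uniqueₚ.map⁺ suc-injective u) ,
    Avoids-∷-min 1<v (Equivalence.to (Avoids-shift 1 v) avoids)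
    where
    1<v : All (1 <_) (map (1 +_) v)
    1<v = Allₚ.map⁺ (All.map (λ (1≤x , _) → s≤s 1≤x) bounds)

  appendRun-avoider : ∀ {m j u} → j < m → suc j < k → Avoider (m ∸ j) u → Avoider (suc m) (appendRun j u)
  appendRun-avoider {m} {j} {u} j<m 1+j<k ((len , bounds , unique) , avoids) =
    (|w| , Allₚ.++⁺ boundsA boundsB ,
     Uniqueₚ.++⁺ (Uniqueₚ.map⁺ (+-cancelˡ-≡ (suc j) _ _) unique) (AllPairs.map <⇒≢ (range-increasing 1 (suc j)))
                 (λ (x∈A , x∈B) → <-irrefl refl (All.lookup (All.lookup A>B x∈A) x∈B))) ,
    Avoids-++-above A>B (range-increasing 1 (suc j)) (subst (_< k) (sym (range-length 1 (suc j))) 1+j<k)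
      (Equivalence.to (Avoids-shift (suc j) u) avoids)
    where
    A = map (suc j +_) u
    B = range 1 (suc j)
    |w| : length (A ++ B) ≡ suc m
    |w| = begin
      length (A ++ B)           ≡⟨ length-++ A ⟩
      length A + length B       ≡⟨ cong₂ _+_ (trans (length-map (suc j +_) u) len) (range-length 1 (suc j)) ⟩
      (m ∸ j) + suc j           ≡⟨ +-suc (m ∸ j) j ⟩
      suc (m ∸ j + j)           ≡⟨ cong suc (m∸n+n≡m (<⇒≤ j<m)) ⟩
      suc m                     ∎
      where open ≡-Reasoning
    A>B : Above A B
    A>B = Allₚ.map⁺ (All.map (λ {x} (1≤x , _) → All.tabulate λ b∈ →
            <-≤-trans (proj₂ (∈-range⁻ 1 (suc j) b∈))
                      (subst (_≤ suc j + x) (+-comm (suc j) 1) (+-monoʳ-≤ (suc j) 1≤x)))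
          bounds)
    boundsA : All (λ x → 1 ≤ x × x ≤ suc m) A
    boundsA = Allₚ.map⁺ (All.map (λ (_ , x≤m∸j) →
                s≤s z≤n , s≤s (≤-trans (+-monoʳ-≤ j x≤m∸j) (≤-reflexive (m+[n∸m]≡n (<⇒≤ j<m)))))
              bounds)
    boundsB : All (λ x → 1 ≤ x × x ≤ suc m) B
    boundsB = All.tabulate λ b∈ →
      let 1≤b , b<2+j = ∈-range⁻ 1 (suc j) b∈ in 1≤b , ≤-trans (s≤s⁻¹ b<2+j) (s≤s (<⇒≤ j<m))

  unshift : ∀ c {n} xs → length xs ≡ n → All (λ x → c < x × x ≤ c + n) xs → Unique xs → Avoids xs →
    Σ[ ys ∈ List ℕ ] map (c +_) ys ≡ xs × Avoider n ys
  unshift c xs len bounds u avoids =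
    ys , eq ,
    IsPerm-unshift c ys (trans (cong length eq) len) (subst (All _) (sym eq) bounds) (subst Unique (sym eq) u) ,
    Equivalence.from (Avoids-shift c ys) (subst Avoids (sym eq) avoids)
    where
    ys = map (_∸ c) xs
    eq : map (c +_) ys ≡ xs
    eq = shift-unshift c xs (All.map (<⇒≤ ∘ proj₁) bounds)

  1∈ : ∀ {m w} → IsPerm (suc m) w → 1 ∈ w
  1∈ {m} {w} (len , bounds , u) with 1 ∈? w
  ... | yes 1∈w = 1∈w
  ... | no  1∉w = ⊥-elim (1+n≰n (subst (_≤ m) len (Unique-bounded 2 m u (All.tabulate above1))))
    where
    above1 : ∀ {x} → x ∈ w → 2 ≤ x × x < 2 + m
    above1 {x} x∈ = let 1≤x , x≤1+m = All.lookup bounds x∈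
                    in ≤∧≢⇒< 1≤x (λ 1≡x → 1∉w (subst (_∈ w) (sym 1≡x) x∈)) , s≤s x≤1+m

  module Decomposition {m} (α β : List ℕ)
    (|w| : length (α ++ 1 ∷ β) ≡ suc m) (w-bounds : All (λ x → 1 ≤ x × x ≤ suc m) (α ++ 1 ∷ β))
    (w-unique : Unique (α ++ 1 ∷ β)) (no213 : ¬ Has Shape213 (α ++ 1 ∷ β))
    (no4132 : ¬ Has Shape4132 (α ++ 1 ∷ β)) (noTauTail : ¬ Has (TauTail k) (α ++ 1 ∷ β)) where

    α-unique : Unique α
    α-unique = proj₁ (AllPairs-++⁻ α w-unique)

    1∷β-unique : Unique (1 ∷ β)
    1∷β-unique = proj₁ (proj₂ (AllPairs-++⁻ α w-unique))

    α-β-distinct : All (λ a → All (a ≢_) (1 ∷ β)) α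
    α-β-distinct = proj₂ (proj₂ (AllPairs-++⁻ α w-unique))

    α-bounds : All (λ a → 1 < a × a ≤ suc m) α
    α-bounds = All.zipWith (λ (a≢ , 1≤a , a≤) → ≤∧≢⇒< 1≤a (≢-sym (All.head a≢)) , a≤)
                           (α-β-distinct , Allₚ.++⁻ˡ α w-bounds)

    β-bounds : All (λ b → 1 < b × b ≤ suc m) β
    β-bounds with 1∷β-unique | Allₚ.++⁻ʳ α w-bounds
    ... | 1∉β ∷ _ | _ ∷ bounds′ = All.zipWith (λ (1≢b , 1≤b , b≤) → ≤∧≢⇒< 1≤b 1≢b , b≤) (1∉β , bounds′)

    α-above-β : Above α β
    α-above-β = All.tabulate λ {a} a∈ → All.tabulate λ {b} b∈ → b<a a∈ b∈
      where
      b<a : ∀ {a b} → a ∈ α → b ∈ β → b < a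
      b<a {a} {b} a∈ b∈ with b <? a
      ... | yes b<a = b<a
      ... | no b≮a = ⊥-elim (no213 (a ∷ 1 ∷ b ∷ [] , ++⁺ (from∈ a∈) (refl ∷ from∈ b∈) ,
                                    proj₁ (All.lookup α-bounds a∈) ,
                                    ≤∧≢⇒< (≮⇒≥ b≮a) (All.lookup (All.lookup α-β-distinct a∈) (there b∈))))

    β-unique : Unique β
    β-unique = AllPairs.tail 1∷β-unique

    |α|+|β|+1 : length α + suc (length β) ≡ suc m
    |α|+|β|+1 = trans (sym (length-++ α)) |w|

    β-increasing : ∀ {a} → a ∈ α → Increasing β
    β-increasing {a} a∈ = unique-pairs⇒increasing β-unique no-descent
      where
      no-descent : ∀ {x y} → x ∷ y ∷ [] ⊆ β → ¬ y < x
      no-descent {x} {y} xy⊆β y<x with All-resp-⊆ xy⊆β β-bounds | All-resp-⊆ xy⊆β (All.lookup α-above-β a∈)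
      ... | _ ∷ (1<y , _) ∷ [] | x<a ∷ _ =
        no4132 (a ∷ 1 ∷ x ∷ y ∷ [] , ++⁺ (from∈ a∈) (refl ∷ xy⊆β) , 1<y , y<x , x<a)

    run-short : ∀ {a} → a ∈ α → suc (length β) < k
    run-short {a} a∈ with suc (length β) <? k
    ... | yes 1+|β|<k = 1+|β|<k
    ... | no  1+|β|≮k = ⊥-elim (noTauTail (a ∷ take k (1 ∷ β) , ++⁺ (from∈ a∈) (take-⊆ k (1 ∷ β)) ,
        trans (length-take k (1 ∷ β)) (m≤n⇒m⊓n≡m (≮⇒≥ 1+|β|≮k)) ,
        APₚ.take⁺ k (All.map proj₁ β-bounds ∷ β-increasing a∈) ,
        Allₚ.take⁺ k (proj₁ (All.lookup α-bounds a∈) ∷ All.lookup α-above-β a∈)))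

    β-max : ∀ {b} → b ∈ β → b ≤ suc (length β)
    β-max {b} b∈ = +-cancelˡ-≤ (length α) b (suc (length β)) (begin
      length α + b        ≤⟨ +-monoˡ-≤ b (Unique-bounded (suc b) (suc m ∸ b) α-unique α-range) ⟩
      (suc m ∸ b) + b     ≡⟨ m∸n+n≡m b≤1+m ⟩
      suc m               ≡⟨ sym |α|+|β|+1 ⟩
      length α + suc (length β) ∎)
      where
      open ≤-Reasoning
      b≤1+m = proj₂ (All.lookup β-bounds b∈)
      α-range : All (λ a → suc b ≤ a × a < suc b + (suc m ∸ b)) α
      α-range = All.zipWith (λ {a} (b<a , (_ , a≤1+m)) → b<a , s≤s (subst (a ≤_) (sym (m+[n∸m]≡n b≤1+m)) a≤1+m))
                            (All.map (λ b<β → All.lookup b<β b∈) α-above-β , α-bounds)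

    α-min : ∀ {a} → a ∈ α → 2 + length β ≤ a
    α-min {a} a∈ = ≤-trans (+-monoʳ-≤ 2 (Unique-bounded 2 (a ∸ 2) β-unique β-range)) (≤-reflexive (m+[n∸m]≡n 2≤a))
      where
      2≤a = proj₁ (All.lookup α-bounds a∈)
      β-range : All (λ b → 2 ≤ b × b < 2 + (a ∸ 2)) β
      β-range = All.zipWith (λ {b} ((1<b , _) , b<a) → 1<b , subst (b <_) (sym (m+[n∸m]≡n 2≤a)) b<a)
                            (β-bounds , All.lookup α-above-β a∈)

    β≡range : ∀ {a} → a ∈ α → β ≡ range 2 (length β)
    β≡range a∈ =
      increasing⇒range 2 β (β-increasing a∈) (All.tabulate λ b∈ → proj₁ (All.lookup β-bounds b∈) , s≤s (β-max b∈))

  decompose : ∀ {m w} → Avoider (suc m) w →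
    (Σ[ v ∈ List ℕ ] w ≡ prependMin v × Avoider m v) ⊎
    (Σ[ j ∈ ℕ ] j < m × suc j < k × Σ[ u ∈ List ℕ ] w ≡ appendRun j u × Avoider (m ∸ j) u)
  decompose {m} (perm@(|w| , bounds , unique) , avoids@(no213 , no4132 , noTauTail)) with ∈-∃++ (1∈ perm)
  ... | [] , β , refl =
    let v , eq , v-avoider = unshift 1 β (suc-injective |w|) β-bounds β-unique (Avoids-⊆ (1 ∷ʳ ⊆-refl) avoids)
    in inj₁ (v , cong (1 ∷_) (sym eq) , v-avoider)
    where open Decomposition [] β |w| bounds unique no213 no4132 noTauTail
  ... | α@(a ∷ _) , β , refl =
    let u , eq , u-avoider = unshift (suc j) α |α| α-bounds′ α-unique (Avoids-⊆ (++⁺ʳ (1 ∷ β) ⊆-refl) avoids)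
    in inj₂ (j , j<m , run-short a∈ , u , cong₂ (λ A B → A ++ 1 ∷ B) (sym eq) (β≡range a∈) , u-avoider)
    where
    open Decomposition α β |w| bounds unique no213 no4132 noTauTail
    j = length β
    a∈ : a ∈ α
    a∈ = here refl
    |α|+j : length α + j ≡ m
    |α|+j = suc-injective (trans (sym (+-suc (length α) j)) |α|+|β|+1)
    j<m : j < m
    j<m = subst (j <_) |α|+j (m<n+m j (s≤s z≤n))
    |α| : length α ≡ m ∸ j
    |α| = trans (sym (m+n∸n≡m (length α) j)) (cong (_∸ j) |α|+j)
    α-bounds′ : All (λ a → suc j < a × a ≤ suc j + (m ∸ j)) α
    α-bounds′ = All.tabulate λ {a} a∈′ →
      α-min a∈′ , subst (a ≤_) (sym (cong suc (m+[n∸m]≡n (<⇒≤ j<m)))) (proj₂ (All.lookup α-bounds a∈′))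

  runLengths : ℕ → List ℕ
  runLengths m = upTo (m ⊓ (k ∸ 1))

  ∈-runLengths⁻ : ∀ {m j} → j ∈ runLengths m → j < m × suc j < k
  ∈-runLengths⁻ {m} j∈ = let j<m⊓k-1 = ∈-upTo⁻ j∈ in
    m<n⊓o⇒m<n m _ j<m⊓k-1 , <-≤-trans (s≤s (m<n⊓o⇒m<o m _ j<m⊓k-1)) (≤-reflexive (m+[n∸m]≡n 1≤k))

  ∈-runLengths⁺ : ∀ {m j} → j < m → suc j < k → j ∈ runLengths m
  ∈-runLengths⁺ j<m 1+j<k = ∈-upTo⁺ (⊓-glb j<m (∸-monoˡ-≤ 1 1+j<k))

  -- The fuel f ≥ m makes the recursion on the size m structural.
  generate : ℕ → ℕ → List (List ℕ)
  generate _       zero    = [] ∷ []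
  generate zero    (suc m) = []
  generate (suc f) (suc m) =
    map prependMin (generate f m) ++ concatMap (λ j → map (appendRun j) (generate f (m ∸ j))) (runLengths m)

  Avoids-[] : Avoids []
  Avoids-[] = (λ { ([] , [] , ()) }) , (λ { ([] , [] , ()) }) , (λ { ([] , [] , ()) })

  generate-sound : ∀ f m → m ≤ f → ∀ {w} → w ∈ generate f m → Avoider m w
  generate-sound _       zero    _         (here refl) = (refl , [] , []) , Avoids-[]
  generate-sound (suc f) (suc m) (s≤s m≤f) w∈ with ∈-++⁻ (map prependMin (generate f m)) w∈
  ... | inj₁ w∈₁ with ∈-map⁻ prependMin w∈₁
  ...   | v , v∈ , refl = prependMin-avoider (generate-sound f m m≤f v∈)
  generate-sound (suc f) (suc m) (s≤s m≤f) w∈ | inj₂ w∈₂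
    with find (∈-concatMap⁻ (λ j → map (appendRun j) (generate f (m ∸ j))) {xs = runLengths m} w∈₂)
  ... | j , j∈ , w∈₃ with ∈-map⁻ (appendRun j) w∈₃
  ...   | u , u∈ , refl =
    let j<m , 1+j<k = ∈-runLengths⁻ j∈
    in appendRun-avoider j<m 1+j<k (generate-sound f (m ∸ j) (≤-trans (m∸n≤m m j) m≤f) u∈)

  generate-complete : ∀ f m → m ≤ f → ∀ {w} → Avoider m w → w ∈ generate f m
  generate-complete _       zero    _ {[]}    _             = here refl
  generate-complete _       zero    _ {_ ∷ _} ((() , _) , _)
  generate-complete (suc f) (suc m) (s≤s m≤f) avoider with decompose avoider
  ... | inj₁ (v , refl , v-avoider) = ∈-++⁺ˡ (∈-map⁺ prependMin (generate-complete f m m≤f v-avoider))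
  ... | inj₂ (j , j<m , 1+j<k , u , refl , u-avoider) =
    ∈-++⁺ʳ _ (∈-concatMap⁺ (λ j → map (appendRun j) (generate f (m ∸ j))) {xs = runLengths m}
               (lose (∈-runLengths⁺ j<m 1+j<k)
                     (∈-map⁺ (appendRun j) (generate-complete f (m ∸ j) (≤-trans (m∸n≤m m j) m≤f) u-avoider))))

  prependMin-injective : ∀ {v v′} → prependMin v ≡ prependMin v′ → v ≡ v′
  prependMin-injective eq = map-injective suc-injective (∷-injectiveʳ eq)

  appendRun-injective : ∀ j {u u′} → appendRun j u ≡ appendRun j u′ → u ≡ u′
  appendRun-injective j eq = map-injective (+-cancelˡ-≡ (suc j) _ _) (++-cancelʳ (range 1 (suc j)) _ _ eq)

  last-appendRun : ∀ j u → last (appendRun j u) ≡ just (suc j)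
  last-appendRun j u = trans (last-++ (map (suc j +_) u)) (last-range 1 j)

  generate-unique : ∀ f m → m ≤ f → Unique (generate f m)
  generate-unique _       zero    _         = [] ∷ []
  generate-unique (suc f) (suc m) (s≤s m≤f) =
    Uniqueₚ.++⁺ (Uniqueₚ.map⁺ prependMin-injective (generate-unique f m m≤f))
      (Uniqueₚ.concat⁺
        (Allₚ.map⁺ {f = runs} (All.tabulate λ {j} _ →
          Uniqueₚ.map⁺ (appendRun-injective j) (generate-unique f (m ∸ j) (≤-trans (m∸n≤m m j) m≤f))))
        (APₚ.map⁺ {f = runs} (AllPairs.map runs-disjoint (Uniqueₚ.upTo⁺ (m ⊓ (k ∸ 1))))))
      prepended-disjoint
    where
    runs : ℕ → List (List ℕ)
    runs j = map (appendRun j) (generate f (m ∸ j))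
    runs-disjoint : ∀ {i j} → i ≢ j → ∀ {w} → ¬ (w ∈ runs i × w ∈ runs j)
    runs-disjoint i≢j (w∈ᵢ , w∈ⱼ) with ∈-map⁻ _ w∈ᵢ | ∈-map⁻ _ w∈ⱼ
    ... | u , _ , refl | u′ , _ , eq = i≢j (suc-injective (just-injective
      (trans (sym (last-appendRun _ u)) (trans (cong last eq) (last-appendRun _ u′)))))
    -- prependMin v starts with 1, appendRun j u with u a nonempty avoider does not.
    prepended-disjoint : ∀ {w} → ¬ (w ∈ map prependMin (generate f m) × w ∈ concatMap runs (runLengths m))
    prepended-disjoint (w∈₁ , w∈₂) with ∈-map⁻ prependMin w∈₁ | find (∈-concatMap⁻ runs {xs = runLengths m} w∈₂)
    ... | _ , _ , refl | j , j∈ , w∈₃ with ∈-map⁻ (appendRun j) w∈₃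
    ... | u , u∈ , eq with generate-sound f (m ∸ j) (≤-trans (m∸n≤m m j) m≤f) u∈
    ... | (len , bounds , _) , _ with u | len | bounds
    ...   | [] | |u|≡m∸j | _ = <-irrefl |u|≡m∸j (m<n⇒0<n∸m (proj₁ (∈-runLengths⁻ j∈)))
    ...   | a ∷ _ | _ | (1≤a , _) ∷ _ = <-irrefl (∷-injectiveˡ eq) (s≤s (≤-trans 1≤a (m≤n+m a j)))

  length-generate : ∀ f m → length (generate (suc f) (suc m)) ≡
    length (generate f m) + sum (map (λ j → length (generate f (m ∸ j))) (runLengths m))
  length-generate f m = begin
    length (map prependMin (generate f m) ++ concatMap runs (runLengths m))
      ≡⟨ length-++ (map prependMin (generate f m)) ⟩
    length (map prependMin (generate f m)) + length (concatMap runs (runLengths m))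
      ≡⟨ cong₂ _+_ (length-map prependMin (generate f m)) (length-concatMap runs (runLengths m)) ⟩
    length (generate f m) + sum (map (length ∘ runs) (runLengths m))
      ≡⟨ cong (λ xs → length (generate f m) + sum xs)
              (map-cong-local {f = length ∘ runs} {xs = runLengths m}
                 (All.tabulate λ {j} _ → length-map (appendRun j) (generate f (m ∸ j)))) ⟩
    length (generate f m) + sum (map (λ j → length (generate f (m ∸ j))) (runLengths m)) ∎
    where
    open ≡-Reasoning
    runs : ℕ → List (List ℕ)
    runs j = map (appendRun j) (generate f (m ∸ j))

  count : ∀ f m → m ≤ f → aSeq k (suc m) ≡ length (generate f m)
  count f m m≤f = begin
    length avoiding                     ≡⟨ Unique-length-≡ avoiding-unique generated-unique avoiding⊆ ⊆avoiding ⟩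
    length (map (0 ∷_) (generate f m))  ≡⟨ length-map (0 ∷_) (generate f m) ⟩
    length (generate f m)               ∎
    where
    open ≡-Reasoning
    patterns = p1324 ∷ tau k ∷ []
    avoiding = filterᵇ (avoidsAll patterns) (circPerms (suc m))
    avoiding-unique : Unique avoiding
    avoiding-unique = Uniqueₚ.filter⁺ (T? ∘ avoidsAll patterns)
                        (Uniqueₚ.filter⁺ (T? ∘ Canonical) (allLists-unique (suc m) (suc m)))
    generated-unique : Unique (map (0 ∷_) (generate f m))
    generated-unique = Uniqueₚ.map⁺ ∷-injectiveʳ (generate-unique f m m≤f)
    avoiding⊆ : ∀ {σ} → σ ∈ avoiding → σ ∈ map (0 ∷_) (generate f m)
    avoiding⊆ σ∈ with ∈-filter⁻ (T? ∘ avoidsAll patterns) σ∈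
    ... | σ∈′ , t with ∈-circPerms⁻ m σ∈′
    ... | w , refl , perm@(_ , bounds , _) =
      ∈-map⁺ (0 ∷_) (generate-complete f m m≤f
        (perm , Equivalence.to (avoidsAll⇔Avoids (All.map proj₁ bounds)) t))
    ⊆avoiding : ∀ {σ} → σ ∈ map (0 ∷_) (generate f m) → σ ∈ avoiding
    ⊆avoiding σ∈ with ∈-map⁻ (0 ∷_) σ∈
    ... | w , w∈ , refl with generate-sound f m m≤f w∈
    ... | perm@(_ , bounds , _) , avoids =
      ∈-filter⁺ (T? ∘ avoidsAll patterns) (∈-circPerms⁺ m perm)
        (Equivalence.from (avoidsAll⇔Avoids (All.map proj₁ bounds)) avoids)

  aSeq-step : ∀ m → aSeq k (2 + m) ≡ aSeq k (1 + m) + sum (map (λ j → aSeq k (1 + (m ∸ j))) (runLengths m))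
  aSeq-step m = begin
    aSeq k (2 + m)                        ≡⟨ count (suc m) (suc m) ≤-refl ⟩
    length (generate (suc m) (suc m))     ≡⟨ length-generate m m ⟩
    length (generate m m) + sum (map (λ j → length (generate m (m ∸ j))) (runLengths m))
      ≡⟨ sym (cong₂ _+_ (count m m ≤-refl)
                         (cong sum (map-cong-local {xs = runLengths m}
                                      (All.tabulate λ {j} _ → count m (m ∸ j) (m∸n≤m m j))))) ⟩
    aSeq k (1 + m) + sum (map (λ j → aSeq k (1 + (m ∸ j))) (runLengths m)) ∎
    where open ≡-Reasoning

  aSeq-1 : aSeq k 1 ≡ 1
  aSeq-1 = count 0 0 z≤n

  recurrence : ∀ n → k + 1 ≤ n → aSeq k n ≡ aSeq k (n ∸ 1) + sumFrom1 (k ∸ 1) (λ i → aSeq k (n ∸ i))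
  recurrence n k+1≤n with ≤-trans (+-monoˡ-≤ 1 1≤k) k+1≤n
  recurrence (suc (suc m)) k+1≤n | s≤s (s≤s _) = begin
    aSeq k (2 + m)
      ≡⟨ aSeq-step m ⟩
    aSeq k (1 + m) + sum (map (λ j → aSeq k (1 + (m ∸ j))) (upTo (m ⊓ (k ∸ 1))))
      ≡⟨ cong (λ n → aSeq k (1 + m) + sum (map (λ j → aSeq k (1 + (m ∸ j))) (upTo n))) (m≥n⇒m⊓n≡n k∸1≤m) ⟩
    aSeq k (1 + m) + sum (map (λ j → aSeq k (1 + (m ∸ j))) (upTo (k ∸ 1)))
      ≡⟨ cong (λ xs → aSeq k (1 + m) + sum xs) (map-cong-local (All.tabulate λ {i} i∈ →
           cong (aSeq k) (sym (+-∸-assoc 1 (≤-trans (<⇒≤ (∈-upTo⁻ i∈)) k∸1≤m))))) ⟩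
    aSeq k (1 + m) + sumFrom1 (k ∸ 1) (λ i → aSeq k (2 + m ∸ i)) ∎
    where
    open ≡-Reasoning
    k∸1≤m : k ∸ 1 ≤ m
    k∸1≤m = ∸-monoˡ-≤ 1 (s≤s⁻¹ (subst (_≤ 2 + m) (+-comm k 1) k+1≤n))

  partialSum : ℕ → ℕ
  partialSum t = sum (map (λ j → aSeq k (1 + (t ∸ j))) (upTo t))

  partialSum-suc : ∀ t → partialSum (suc t) ≡ aSeq k (2 + t) + partialSum t
  partialSum-suc t =
    cong (aSeq k (2 + t) +_) (cong sum (trans (map-applyUpTo suc g t) (sym (map-upTo (g ∘ suc) t))))
    where
    g : ℕ → ℕ
    g j = aSeq k (1 + (suc t ∸ j))

  aSeq-step-small : ∀ t → t ≤ k ∸ 1 → aSeq k (2 + t) ≡ aSeq k (1 + t) + partialSum t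
  aSeq-step-small t t≤k∸1 =
    trans (aSeq-step t)
          (cong (λ n → aSeq k (1 + t) + sum (map (λ j → aSeq k (1 + (t ∸ j))) (upTo n))) (m≤n⇒m⊓n≡m t≤k∸1))

  fibonacci : ∀ t → t ≤ k ∸ 1 → aSeq k (2 + t) ≡ fib (t + t) × partialSum (suc t) ≡ fib (suc (t + t))
  fibonacci zero    t≤k∸1 = a₂ , trans (partialSum-suc 0) (cong (_+ 0) a₂)
    where
    a₂ : aSeq k 2 ≡ 1
    a₂ = trans (aSeq-step-small 0 t≤k∸1) (cong (_+ 0) aSeq-1)
  fibonacci (suc t) t<k∸1 with fibonacci t (≤-trans (n≤1+n t) t<k∸1)
  ... | a≡ , s≡ = a′ , trans (partialSum-suc (suc t)) (cong₂ _+_ a′ (trans s≡ (cong fib (sym (+-suc t t)))))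
    where
    a′ : aSeq k (3 + t) ≡ fib (suc t + suc t)
    a′ = begin
      aSeq k (3 + t)                      ≡⟨ aSeq-step-small (suc t) t<k∸1 ⟩
      aSeq k (2 + t) + partialSum (suc t) ≡⟨ cong₂ _+_ a≡ s≡ ⟩
      fib (t + t) + fib (suc (t + t))     ≡⟨ +-comm (fib (t + t)) _ ⟩
      fib (suc (suc (t + t)))             ≡⟨ cong (fib ∘ suc) (sym (+-suc t t)) ⟩
      fib (suc t + suc t)                 ∎
      where open ≡-Reasoning

  initialValues : ∀ n → 2 ≤ n → n ≤ k → aSeq k n ≡ fib (2 * n ∸ 4)
  initialValues (suc (suc t)) (s≤s (s≤s _)) n≤k =
    trans (proj₁ (fibonacci t (≤-trans (n≤1+n t) (∸-monoˡ-≤ 1 n≤k)))) (cong fib (sym 2[2+t]∸4≡t+t))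
    where
    2[2+t]≡t+t+4 : ∀ t → 2 * (2 + t) ≡ t + t + 4
    2[2+t]≡t+t+4 = solve-∀
    2[2+t]∸4≡t+t : 2 * (2 + t) ∸ 4 ≡ t + t
    2[2+t]∸4≡t+t = trans (cong (_∸ 4) (2[2+t]≡t+t+4 t)) (m+n∸n≡m (t + t) 4)

proposition4p29 : (k : ℕ) → 1 ≤ k →
    ((n : ℕ) → k + 1 ≤ n →
      aSeq k n ≡ aSeq k (n ∸ 1) + sumFrom1 (k ∸ 1) (λ i → aSeq k (n ∸ i)))
    × ((n : ℕ) → 2 ≤ n → n ≤ k → aSeq k n ≡ fib (2 * n ∸ 4))
proposition4p29 k 1≤k = recurrence , initialValues
  where open Avoiders k 1≤k
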